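{- Let $\lambda$ be a Young diagram, let $\mathcal A_\lambda=\{a(i,j):(i,j)\in\lambda\}$ be the multiset of area numbers and $\mathcal A^\ast_\lambda=\{a^\ast(i,j):(i,j)\in\lambda\}$ the multiset of anti-area numbers. Then $\mathcal A_\lambda$ majorizes $\mathcal A^\ast_\lambda$.
   Context: Let $\lambda=(\lambda_1\ge\dots\ge\lambda_\ell>0)$ be an integer partition; its Young diagram is the set of squares $(i,j)$ with $1\le i\le\ell$, $1\le j\le\lambda_i$. For $(i,j)\in\lambda$: $a(i,j)=|\{(p,q)\in\lambda: i\le p,\ j\le q\}|$ and $a^\ast(i,j)=i\cdot j$. Majorization: for two multisets $\mathcal A,\mathcal B$ of $n$ real numbers, let $a_1\ge\dots\ge a_n$ and $b_1\ge\dots\ge b_n$ be their elements in non-increasing order. $\mathcal A$ majorizes $\mathcal B$ if $a_1+\dots+a_k\ge b_1+\dots+b_k$ for all $1\le k<n$ and $a_1+\dots+a_n=b_1+\dots+b_n$. -}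

module Defs where

open import Data.Nat using (ℕ; zero; suc; _+_; _*_; _≤_; _≥_; _<_)
open import Data.Nat.Properties using (≤-decTotalOrder)
open import Data.List using (List; []; _∷_; length; map; concatMap; upTo; take; reverse; lookup)
open import Data.List.Relation.Unary.All using (All)
open import Data.List.Relation.Unary.Linked using (Linked)
open import Data.Product using (_×_; _,_)
open import Data.Fin using (toℕ)
open import Relation.Binary.PropositionalEquality using (_≡_)
import Data.List.Sort.InsertionSort
open import Data.Nat.ListAction using (sum)

IsPartition : List ℕ → Set
IsPartition ys = Linked _≥_ ys × All (λ k → 0 < k) ys

-- The i-th part λ_i (1-indexed); 0 when i is out of range (i = 0 or i > ℓ).
part : List ℕ → ℕ → ℕ
part []       _             = 0
part (y ∷ ys) zero          = 0
part (y ∷ ys) (suc zero)    = y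
part (y ∷ ys) (suc (suc i)) = part ys (suc i)

-- Cells (i , j) of the Young diagram, 1 ≤ i ≤ ℓ, 1 ≤ j ≤ λ_i.
cells : List ℕ → List (ℕ × ℕ)
cells ys = concatMap (λ i → map (λ j → (suc i , suc j)) (upTo (part ys (suc i)))) (upTo (length ys))

open import Relation.Nullary.Decidable using (⌊_⌋)
open import Data.Nat using (_≤?_)
open import Data.Bool using (Bool; true; false; _∧_)
open import Data.List using (filter; filterᵇ)

area : List ℕ → ℕ × ℕ → ℕ
area ys (i , j) = length (filterᵇ (λ { (p , q) → ⌊ i ≤? p ⌋ ∧ ⌊ j ≤? q ⌋ }) (cells ys))

antiArea : ℕ × ℕ → ℕ
antiArea (i , j) = i * j

-- Multisets, represented as lists (order irrelevant below).
areaMultiset : List ℕ → List ℕ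
areaMultiset ys = map (area ys) (cells ys)

antiAreaMultiset : List ℕ → List ℕ
antiAreaMultiset ys = map antiArea (cells ys)

open Data.List.Sort.InsertionSort ≤-decTotalOrder using (sort)

sortDesc : List ℕ → List ℕ
sortDesc xs = reverse (sort xs)

Majorizes : List ℕ → List ℕ → Set
Majorizes A B =
  length A ≡ length B ×
  (∀ k → 1 ≤ k → k < length A → sum (take k (sortDesc B)) ≤ sum (take k (sortDesc A))) ×
  sum A ≡ sum B

-- A multiset B is majorized by a multiset A of the same size and sum as soon as
-- Σ_{b ∈ B} (b ∸ t) ≤ Σ_{a ∈ A} (a ∸ t) for every threshold t. These excess
-- inequalities are proved by adding the rows of λ one at a time. Appending a row
-- of length x below n rows creates the anti-area numbers (n+1)·1, …, (n+1)·x and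
-- the area numbers x, …, 1, and raises the area number of an old cell (i,j) by
-- w = x ∸ (j − 1). That area number is at least the rectangle number
-- r = (n − i + 1)·w, so by convexity of v ↦ v ∸ t its excess grows at least as
-- much as that of r when w is added; summed over the old cells, the rectangle
-- terms telescope row by row to exactly the excess of {(n+1)k} minus that of {k}.
-- At t = 0 every step is an equality, which gives the equal total sums.
module Submission where

open import Defs
open import Data.Bool using (Bool; true; false; _∧_; T?)
open import Data.List using (List; []; _∷_; _++_; _∷ʳ_; [_]; length; map; concat; concatMap; upTo; filterᵇ; take; drop; reverse)
open import Data.List.Properties
  using (length-++; length-map; map-++; map-∘; map-cong-local; upTo-∷ʳ; concatMap-++; ++-identityʳ; unfold-reverse; filter-++)
open import Data.List.Reverse using (Reverse; []; _∶_∶ʳ_; reverseView)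
open import Data.List.Relation.Unary.All as All using (All; []; _∷_)
import Data.List.Relation.Unary.All.Properties as All
open import Data.List.Relation.Unary.AllPairs using (AllPairs; []; _∷_)
import Data.List.Relation.Unary.AllPairs.Properties as AllPairs
open import Data.List.Relation.Unary.Linked using (Linked; []; [-]; _∷_)
open import Data.List.Relation.Unary.Linked.Properties using (Linked⇒AllPairs)
open import Data.List.Relation.Binary.Permutation.Propositional using (_↭_; ↭-sym; ↭-trans)
open import Data.List.Relation.Binary.Permutation.Propositional.Properties using (All-resp-↭; ↭-reverse; ↭-length; map⁺)
open import Data.Nat
open import Data.Nat.ListAction using (sum)
open import Data.Nat.ListAction.Properties using (sum-++; sum-↭)
open import Data.Nat.Properties
open import Algebra.Properties.CommutativeSemigroup +-commutativeSemigroup using (interchange; xy∙z≈xz∙y)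
open import Data.List.Sort.InsertionSort.Properties ≤-decTotalOrder using (sort-↭; sort-↗)
open import Data.Product using (_×_; _,_; proj₁; ∃-syntax)
open import Function using (_∘_; id; flip)
open import Relation.Binary.PropositionalEquality hiding ([_])
open import Relation.Nullary using (yes; no; contradiction)
open import Relation.Nullary.Decidable using (⌊_⌋)

private
  variable
    A : Set

∑ : ℕ → (ℕ → ℕ) → ℕ
∑ zero    f = 0
∑ (suc m) f = ∑ m f + f m

∑-cong : ∀ m {f g : ℕ → ℕ} → (∀ j → f j ≡ g j) → ∑ m f ≡ ∑ m g
∑-cong zero    f≗g = refl
∑-cong (suc m) f≗g = cong₂ _+_ (∑-cong m f≗g) (f≗g m)

∑-unfoldˡ : ∀ m (f : ℕ → ℕ) → ∑ (suc m) f ≡ f 0 + ∑ m (f ∘ suc)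
∑-unfoldˡ zero    f = +-comm 0 (f 0)
∑-unfoldˡ (suc m) f = begin
  ∑ m f + f m + f (suc m)          ≡⟨ cong (_+ f (suc m)) (∑-unfoldˡ m f) ⟩
  f 0 + ∑ m (f ∘ suc) + f (suc m)  ≡⟨ +-assoc (f 0) _ _ ⟩
  f 0 + ∑ (suc m) (f ∘ suc)        ∎
  where open ≡-Reasoning

∑-reverse : ∀ m (f : ℕ → ℕ) → ∑ m (f ∘ suc) ≡ ∑ m (λ j → f (m ∸ j))
∑-reverse zero    f = refl
∑-reverse (suc m) f = begin
  ∑ m (f ∘ suc) + f (suc m)          ≡⟨ cong (_+ f (suc m)) (∑-reverse m f) ⟩
  ∑ m (λ j → f (m ∸ j)) + f (suc m)  ≡⟨ +-comm _ (f (suc m)) ⟩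
  f (suc m) + ∑ m (λ j → f (m ∸ j))  ≡⟨ ∑-unfoldˡ m (λ j → f (suc m ∸ j)) ⟨
  ∑ (suc m) (λ j → f (suc m ∸ j))    ∎
  where open ≡-Reasoning

∑-vanishing-tail : ∀ {m x} (f : ℕ → ℕ) → m ≤ x → (∀ j → m ≤ j → f j ≡ 0) → ∑ x f ≡ ∑ m f
∑-vanishing-tail {m} f m≤x vanishes = go (≤⇒≤′ m≤x)
  where
    go : ∀ {x} → m ≤′ x → ∑ x f ≡ ∑ m f
    go ≤′-refl             = refl
    go (≤′-step {x} m≤′x) = trans (cong₂ _+_ (go m≤′x) (vanishes x (≤′⇒≤ m≤′x))) (+-identityʳ _)

sum-map-upTo : ∀ m (f : ℕ → ℕ) → sum (map f (upTo m)) ≡ ∑ m f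
sum-map-upTo zero    f = refl
sum-map-upTo (suc m) f = begin
  sum (map f (upTo (suc m)))        ≡⟨ cong (sum ∘ map f) (upTo-∷ʳ m) ⟨
  sum (map f (upTo m ∷ʳ m))         ≡⟨ cong sum (map-++ f (upTo m) [ m ]) ⟩
  sum (map f (upTo m) ∷ʳ f m)       ≡⟨ sum-++ (map f (upTo m)) [ f m ] ⟩
  sum (map f (upTo m)) + (f m + 0)  ≡⟨ cong₂ _+_ (sum-map-upTo m f) (+-identityʳ (f m)) ⟩
  ∑ m f + f m                       ∎
  where open ≡-Reasoning

sum-map-+ : ∀ (f g : A → ℕ) xs → sum (map (λ x → f x + g x) xs) ≡ sum (map f xs) + sum (map g xs)
sum-map-+ f g []       = refl
sum-map-+ f g (x ∷ xs) = trans (cong (f x + g x +_) (sum-map-+ f g xs)) (interchange (f x) (g x) _ _)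

sum-map-mono : ∀ {f g : A → ℕ} {xs} → All (λ x → f x ≤ g x) xs → sum (map f xs) ≤ sum (map g xs)
sum-map-mono []             = z≤n
sum-map-mono (fx≤gx ∷ f≤g) = +-mono-≤ fx≤gx (sum-map-mono f≤g)

excess : ℕ → List ℕ → ℕ
excess t xs = sum (map (_∸ t) xs)

excess≡0 : ∀ {t xs} → All (_≤ t) xs → excess t xs ≡ 0
excess≡0 []             = refl
excess≡0 (x≤t ∷ xs≤t) = cong₂ _+_ (m≤n⇒m∸n≡0 x≤t) (excess≡0 xs≤t)

sum-take≤ : ∀ k t xs → sum (take k xs) ≤ k * t + excess t xs
sum-take≤ zero    t xs       = z≤n
sum-take≤ (suc k) t []       = z≤n
sum-take≤ (suc k) t (x ∷ xs) = begin
  x + sum (take k xs)                    ≤⟨ +-mono-≤ (m≤n+m∸n x t) (sum-take≤ k t xs) ⟩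
  (t + (x ∸ t)) + (k * t + excess t xs)  ≡⟨ interchange t (x ∸ t) (k * t) (excess t xs) ⟩
  suc k * t + excess t (x ∷ xs)          ∎
  where open ≤-Reasoning

sum-take≡ : ∀ k t xs → k ≤ length xs → All (t ≤_) (take k xs) → All (_≤ t) (drop k xs) →
            k * t + excess t xs ≡ sum (take k xs)
sum-take≡ zero    t xs       _           _            low = excess≡0 low
sum-take≡ (suc k) t (x ∷ xs) (s≤s k≤n) (t≤x ∷ high) low = begin
  (t + k * t) + ((x ∸ t) + excess t xs)  ≡⟨ interchange t (k * t) (x ∸ t) (excess t xs) ⟩
  (t + (x ∸ t)) + (k * t + excess t xs)  ≡⟨ cong₂ _+_ (m+[n∸m]≡n t≤x) (sum-take≡ k t xs k≤n high low) ⟩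
  x + sum (take k xs)                    ∎
  where open ≡-Reasoning

descending-split : ∀ {xs} → AllPairs _≥_ xs → ∀ k → k < length xs →
                   ∃[ t ] All (t ≤_) (take (suc k) xs) × All (_≤ t) (drop (suc k) xs)
descending-split {x ∷ xs}     (x≥xs ∷ _)               zero    _          = x , (≤-refl ∷ []) , x≥xs
descending-split {x ∷ y ∷ xs} ((x≥y ∷ _) ∷ descending) (suc k) (s≤s k<n)
  with descending-split descending k k<n
... | t , (t≤y ∷ high) , low = t , (≤-trans t≤y x≥y ∷ t≤y ∷ high) , low

AllPairs-reverse : ∀ {R : A → A → Set} {xs} → AllPairs R xs → AllPairs (flip R) (reverse xs)
AllPairs-reverse {xs = []}     []         = []
AllPairs-reverse {xs = x ∷ xs} (Rx ∷ Rxs) rewrite unfold-reverse x xs =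
  AllPairs.++⁺ (AllPairs-reverse Rxs) ([] ∷ [])
    (All.map (_∷ []) (All-resp-↭ (↭-sym (↭-reverse xs)) Rx))

sortDesc-↭ : ∀ xs → sortDesc xs ↭ xs
sortDesc-↭ xs = ↭-trans (↭-reverse _) (sort-↭ xs)

sortDesc-descending : ∀ xs → AllPairs _≥_ (sortDesc xs)
sortDesc-descending xs = AllPairs-reverse (Linked⇒AllPairs ≤-trans (sort-↗ xs))

excess-sortDesc : ∀ t xs → excess t (sortDesc xs) ≡ excess t xs
excess-sortDesc t xs = sum-↭ (map⁺ (_∸ t) (sortDesc-↭ xs))

excess≤⇒majorizes : ∀ A B → length A ≡ length B → sum A ≡ sum B →
                    (∀ t → excess t B ≤ excess t A) → Majorizes A B
excess≤⇒majorizes A B |A|≡|B| ΣA≡ΣB B≤A = |A|≡|B| , prefix-sums , ΣA≡ΣB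
  where
    fits : ∀ {k} → k < length A → k ≤ length (sortDesc A)
    fits k<|A| = subst (_ ≤_) (sym (↭-length (sortDesc-↭ A))) (<⇒≤ k<|A|)

    -- t is the k-th largest element of A, for which sum-take≤ is an equality on A.
    prefix-sums : ∀ k → 1 ≤ k → k < length A → sum (take k (sortDesc B)) ≤ sum (take k (sortDesc A))
    prefix-sums (suc k) _ k<|A|
      with t , high , low ← descending-split (sortDesc-descending A) k (fits k<|A|) = begin
      sum (take (suc k) (sortDesc B))    ≤⟨ sum-take≤ (suc k) t (sortDesc B) ⟩
      suc k * t + excess t (sortDesc B)  ≡⟨ cong (suc k * t +_) (excess-sortDesc t B) ⟩
      suc k * t + excess t B             ≤⟨ +-monoʳ-≤ (suc k * t) (B≤A t) ⟩
      suc k * t + excess t A             ≡⟨ cong (suc k * t +_) (excess-sortDesc t A) ⟨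
      suc k * t + excess t (sortDesc A)  ≡⟨ sum-take≡ (suc k) t (sortDesc A) (fits k<|A|) high low ⟩
      sum (take (suc k) (sortDesc A))    ∎
      where open ≤-Reasoning

length-∷ʳ : ∀ (xs : List A) x → length (xs ∷ʳ x) ≡ suc (length xs)
length-∷ʳ xs x = trans (length-++ xs) (+-comm (length xs) 1)

part-∷ʳ-< : ∀ ys m i → i < length ys → part (ys ∷ʳ m) (suc i) ≡ part ys (suc i)
part-∷ʳ-< (y ∷ ys) m zero    _         = refl
part-∷ʳ-< (y ∷ ys) m (suc i) (s≤s i<n) = part-∷ʳ-< ys m i i<n

part-∷ʳ-length : ∀ ys m → part (ys ∷ʳ m) (suc (length ys)) ≡ m
part-∷ʳ-length []       m = refl
part-∷ʳ-length (y ∷ ys) m = part-∷ʳ-length ys m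

row : ℕ → ℕ → List (ℕ × ℕ)
row i m = map (λ j → (suc i , suc j)) (upTo m)

cells-∷ʳ : ∀ ys m → cells (ys ∷ʳ m) ≡ cells ys ++ row (length ys) m
cells-∷ʳ ys m = begin
  concatMap rows′ (upTo (length (ys ∷ʳ m)))     ≡⟨ cong (concatMap rows′ ∘ upTo) (length-∷ʳ ys m) ⟩
  concatMap rows′ (upTo (suc n))                ≡⟨ cong (concatMap rows′) (upTo-∷ʳ n) ⟨
  concatMap rows′ (upTo n ∷ʳ n)                 ≡⟨ concatMap-++ rows′ (upTo n) [ n ] ⟩
  concatMap rows′ (upTo n) ++ (rows′ n ++ [])   ≡⟨ cong₂ _++_ old-rows (trans (++-identityʳ _) new-row) ⟩
  concatMap rows (upTo n) ++ row n m            ∎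
  where
    open ≡-Reasoning
    n = length ys
    rows rows′ : ℕ → List (ℕ × ℕ)
    rows  i = row i (part ys (suc i))
    rows′ i = row i (part (ys ∷ʳ m) (suc i))
    old-rows : concatMap rows′ (upTo n) ≡ concatMap rows (upTo n)
    old-rows = cong concat (map-cong-local
      (All.applyUpTo⁺₁ id n (λ {i} i<n → cong (row i) (part-∷ʳ-< ys m i i<n))))
    new-row : rows′ n ≡ row n m
    new-row = cong (row n) (part-∷ʳ-length ys m)

cells-row≤length : ∀ ys → All (λ c → proj₁ c ≤ length ys) (cells ys)
cells-row≤length ys = All.concat⁺ (All.map⁺ (All.applyUpTo⁺₁ id (length ys)
  (λ i<n → All.map⁺ (All.applyUpTo⁺₂ id _ (λ _ → i<n)))))

-- area ys c is definitionally count (c ≤₂ᵇ_) (cells ys).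
_≤₂ᵇ_ : ℕ × ℕ → ℕ × ℕ → Bool
(i , j) ≤₂ᵇ (p , q) = ⌊ i ≤? p ⌋ ∧ ⌊ j ≤? q ⌋

count : (A → Bool) → List A → ℕ
count p xs = length (filterᵇ p xs)

count-++ : ∀ (p : A → Bool) xs ys → count p (xs ++ ys) ≡ count p xs + count p ys
count-++ p xs ys = trans (cong length (filter-++ (T? ∘ p) xs ys)) (length-++ (filterᵇ p xs))

count-map : ∀ {B : Set} (p : B → Bool) (f : A → B) xs → count p (map f xs) ≡ count (p ∘ f) xs
count-map p f []       = refl
count-map p f (x ∷ xs) with p (f x)
... | true  = cong suc (count-map p f xs)
... | false = count-map p f xs

count-none : ∀ {p : A → Bool} {xs} → All (λ x → p x ≡ false) xs → count p xs ≡ 0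
count-none []                   = refl
count-none (px≡false ∷ pxs≡false) rewrite px≡false = count-none pxs≡false

count-upTo : ∀ x k → count (λ j → ⌊ k ≤? suc j ⌋) (upTo x) ≡ x ∸ pred k
count-upTo zero    k = sym (0∸n≡0 (pred k))
count-upTo (suc x) k = begin
  count p (upTo (suc x))            ≡⟨ cong (count p) (upTo-∷ʳ x) ⟨
  count p (upTo x ∷ʳ x)             ≡⟨ count-++ p (upTo x) [ x ] ⟩
  count p (upTo x) + count p [ x ]  ≡⟨ cong (_+ count p [ x ]) (count-upTo x k) ⟩
  (x ∸ pred k) + count p [ x ]      ≡⟨ last-column ⟩
  suc x ∸ pred k                    ∎
  where
    open ≡-Reasoning
    p : ℕ → Bool
    p j = ⌊ k ≤? suc j ⌋
    last-column : (x ∸ pred k) + count p [ x ] ≡ suc x ∸ pred k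
    last-column with k ≤? suc x
    ... | yes k≤1+x = trans (+-comm _ 1) (sym (+-∸-assoc 1 (pred-mono-≤ k≤1+x)))
    ... | no  k≰1+x = trans (+-identityʳ _) (trans (m≤n⇒m∸n≡0 (m≤n⇒m≤1+n 1+x≤k-1)) (sym (m≤n⇒m∸n≡0 1+x≤k-1)))
      where
        1+x≤k-1 : suc x ≤ pred k
        1+x≤k-1 = pred-mono-≤ (≰⇒> k≰1+x)

area-outside : ∀ ys {i j} → length ys < i → area ys (i , j) ≡ 0
area-outside ys {i} {j} n<i = count-none (All.map outside (cells-row≤length ys))
  where
    outside : ∀ {c} → proj₁ c ≤ length ys → (i , j) ≤₂ᵇ c ≡ false
    outside {p , q} p≤n with i ≤? p
    ... | yes i≤p = contradiction (≤-trans i≤p p≤n) (<⇒≱ n<i)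
    ... | no  _   = refl

area-∷ʳ : ∀ ys x {i j} → i ≤ suc (length ys) → area (ys ∷ʳ x) (i , j) ≡ area ys (i , j) + (x ∸ pred j)
area-∷ʳ ys x {i} {j} i≤1+n = begin
  count ((i , j) ≤₂ᵇ_) (cells (ys ∷ʳ x))      ≡⟨ cong (count _) (cells-∷ʳ ys x) ⟩
  count ((i , j) ≤₂ᵇ_) (cells ys ++ row n x)  ≡⟨ count-++ _ (cells ys) (row n x) ⟩
  area ys (i , j) + count _ (row n x)         ≡⟨ cong (area ys (i , j) +_) new-row ⟩
  area ys (i , j) + (x ∸ pred j)              ∎
  where
    open ≡-Reasoning
    n = length ys
    new-row : count ((i , j) ≤₂ᵇ_) (row n x) ≡ x ∸ pred j
    new-row rewrite count-map ((i , j) ≤₂ᵇ_) (λ j′ → (suc n , suc j′)) (upTo x) with i ≤? suc n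
    ... | yes _    = count-upTo x j
    ... | no  i≰1+n = contradiction i≤1+n i≰1+n

rectangle : ℕ → ℕ → ℕ × ℕ → ℕ
rectangle a b (i , j) = (a ∸ pred i) * (b ∸ pred j)

rowTail : ℕ → ℕ × ℕ → ℕ
rowTail x (i , j) = x ∸ pred j

rectangle-suc : ∀ a b c → proj₁ c ≤ suc a → rectangle (suc a) b c ≡ rowTail b c + rectangle a b c
rectangle-suc a b (i , j) i≤1+a = cong (_* (b ∸ pred j)) (+-∸-assoc 1 (pred-mono-≤ i≤1+a))

linked-∷ʳ⁻ : ∀ ys {m} → Linked _≥_ (ys ∷ʳ m) → Linked _≥_ ys × All (m ≤_) ys
linked-∷ʳ⁻ []           _                 = [] , []
linked-∷ʳ⁻ (y ∷ [])     (y≥m ∷ _)         = [-] , (y≥m ∷ [])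
linked-∷ʳ⁻ (y ∷ z ∷ ys) (y≥z ∷ z∷ys∷ʳm)
  with z∷ys , (m≤z ∷ m≤ys) ← linked-∷ʳ⁻ (z ∷ ys) z∷ys∷ʳm =
  (y≥z ∷ z∷ys) , (≤-trans m≤z y≥z ∷ m≤z ∷ m≤ys)

rectangle≤area : ∀ {m ys} → All (m ≤_) ys → ∀ c → rectangle (length ys) m c ≤ area ys c
rectangle≤area {m} {ys} = go (reverseView ys)
  where
    go : ∀ {ys} → Reverse ys → All (m ≤_) ys → ∀ c → rectangle (length ys) m c ≤ area ys c
    go []             _         (i , j) = ≤-reflexive (cong (_* (m ∸ pred j)) (0∸n≡0 (pred i)))
    go (xs ∶ rs ∶ʳ x) m≤xs∷ʳx (i , j) with m≤xs , (m≤x ∷ []) ← All.++⁻ xs m≤xs∷ʳx =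
      ≤-trans (≤-reflexive (cong (λ k → rectangle k m (i , j)) (length-∷ʳ xs x))) new-bound
      where
        n = length xs
        new-bound : rectangle (suc n) m (i , j) ≤ area (xs ∷ʳ x) (i , j)
        new-bound with i ≤? suc n
        ... | yes i≤1+n = begin
          rectangle (suc n) m (i , j)           ≡⟨ rectangle-suc n m (i , j) i≤1+n ⟩
          (m ∸ pred j) + rectangle n m (i , j)  ≤⟨ +-mono-≤ (∸-monoˡ-≤ (pred j) m≤x) (go rs m≤xs (i , j)) ⟩
          (x ∸ pred j) + area xs (i , j)        ≡⟨ +-comm _ (area xs (i , j)) ⟩
          area xs (i , j) + (x ∸ pred j)        ≡⟨ area-∷ʳ xs x i≤1+n ⟨
          area (xs ∷ʳ x) (i , j)                ∎
          where open ≤-Reasoning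
        ... | no i≰1+n =
          ≤-trans (≤-reflexive (cong (_* (m ∸ pred j)) (m≤n⇒m∸n≡0 (pred-mono-≤ (≰⇒> i≰1+n))))) z≤n

∑cells : List ℕ → (ℕ × ℕ → ℕ) → ℕ
∑cells ys h = sum (map h (cells ys))

∑cells-∷ʳ : ∀ ys x h → ∑cells (ys ∷ʳ x) h ≡ ∑cells ys h + ∑ x (λ j → h (suc (length ys) , suc j))
∑cells-∷ʳ ys x h = begin
  sum (map h (cells (ys ∷ʳ x)))                    ≡⟨ cong (sum ∘ map h) (cells-∷ʳ ys x) ⟩
  sum (map h (cells ys ++ row n x))                ≡⟨ cong sum (map-++ h (cells ys) (row n x)) ⟩
  sum (map h (cells ys) ++ map h (row n x))        ≡⟨ sum-++ (map h (cells ys)) _ ⟩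
  ∑cells ys h + sum (map h (row n x))              ≡⟨ cong (λ s → ∑cells ys h + sum s) (map-∘ (upTo x)) ⟨
  ∑cells ys h + sum (map (λ j → h (suc n , suc j)) (upTo x))
    ≡⟨ cong (∑cells ys h +_) (sum-map-upTo x _) ⟩
  ∑cells ys h + ∑ x (λ j → h (suc n , suc j))      ∎
  where
    open ≡-Reasoning
    n = length ys

∸-superadditive : ∀ m n t → (m ∸ t) + (n ∸ t) ≤ (m + n) ∸ t
∸-superadditive m       n       zero    = ≤-refl
∸-superadditive zero    n       (suc t) = ≤-refl
∸-superadditive (suc m) zero    (suc t) = ≤-reflexive (trans (+-identityʳ _) (cong (_∸ suc t) (sym (+-identityʳ (suc m)))))
∸-superadditive (suc m) (suc n) (suc t) =
  ≤-trans (∸-superadditive m n t) (∸-monoˡ-≤ t (+-monoʳ-≤ m (n≤1+n n)))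

∸-convex : ∀ t {r a} w → r ≤ a → (a ∸ t) + (w + r ∸ t) ≤ (a + w ∸ t) + (r ∸ t)
∸-convex zero    {r} {a} w _         = ≤-reflexive (sym (+-assoc a w r))
∸-convex (suc t) {a = a} w z≤n       = begin
  (a ∸ suc t) + (w + 0 ∸ suc t)  ≡⟨ cong (λ v → (a ∸ suc t) + (v ∸ suc t)) (+-identityʳ w) ⟩
  (a ∸ suc t) + (w ∸ suc t)      ≤⟨ ∸-superadditive a w (suc t) ⟩
  a + w ∸ suc t                  ≡⟨ +-identityʳ _ ⟨
  (a + w ∸ suc t) + 0            ∎
  where open ≤-Reasoning
∸-convex (suc t) {suc r} w (s≤s r≤a) rewrite +-suc w r = ∸-convex t w r≤a

+-exchange-≤ : ∀ {a b c d e f} → a + c ≤ b + d → e + d ≡ c + f → a + e ≤ b + f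
+-exchange-≤ {a} {b} {c} {d} {e} {f} a+c≤b+d e+d≡c+f = +-cancelʳ-≤ d (a + e) (b + f) (begin
  a + e + d    ≡⟨ +-assoc a e d ⟩
  a + (e + d)  ≡⟨ cong (a +_) e+d≡c+f ⟩
  a + (c + f)  ≡⟨ +-assoc a c f ⟨
  a + c + f    ≤⟨ +-monoˡ-≤ f a+c≤b+d ⟩
  b + d + f    ≡⟨ xy∙z≈xz∙y b d f ⟩
  b + f + d    ∎)
  where open ≤-Reasoning

+-exchange-≡ : ∀ {a b c d e f} → a + c ≡ b + d → e + d ≡ c + f → a + e ≡ b + f
+-exchange-≡ {a} {b} {c} {d} {e} {f} a+c≡b+d e+d≡c+f = +-cancelʳ-≡ d (a + e) (b + f) (begin
  a + e + d    ≡⟨ +-assoc a e d ⟩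
  a + (e + d)  ≡⟨ cong (a +_) e+d≡c+f ⟩
  a + (c + f)  ≡⟨ +-assoc a c f ⟨
  a + c + f    ≡⟨ cong (_+ f) a+c≡b+d ⟩
  b + d + f    ≡⟨ xy∙z≈xz∙y b d f ⟩
  b + f + d    ∎)
  where open ≡-Reasoning

-- The excess over t of {k, 2k, …, mk}, listed from mk down so that the terms j ≥ m vanish.
rowExcess : ℕ → ℕ → ℕ → ℕ
rowExcess t m k = ∑ m (λ j → k * (m ∸ j) ∸ t)

∑cells-rectangle : ∀ t {m ys} → All (m ≤_) ys → ∀ a →
                   ∑cells ys (λ c → rectangle a m c ∸ t) ≡ ∑ (length ys) (λ i → rowExcess t m (a ∸ i))
∑cells-rectangle t {m} {ys} = go (reverseView ys)
  where
    go : ∀ {ys} → Reverse ys → All (m ≤_) ys → ∀ a →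
         ∑cells ys (λ c → rectangle a m c ∸ t) ≡ ∑ (length ys) (λ i → rowExcess t m (a ∸ i))
    go []             _        a = refl
    go (xs ∶ rs ∶ʳ x) m≤xs∷ʳx a with m≤xs , (m≤x ∷ []) ← All.++⁻ xs m≤xs∷ʳx = begin
      ∑cells (xs ∷ʳ x) (λ c → rectangle a m c ∸ t)
        ≡⟨ ∑cells-∷ʳ xs x _ ⟩
      ∑cells xs (λ c → rectangle a m c ∸ t) + ∑ x (λ j → (a ∸ n) * (m ∸ j) ∸ t)
        ≡⟨ cong₂ _+_ (go rs m≤xs a) (∑-vanishing-tail _ m≤x beyond-m) ⟩
      ∑ (suc n) (λ i → rowExcess t m (a ∸ i))
        ≡⟨ cong (λ k → ∑ k (λ i → rowExcess t m (a ∸ i))) (length-∷ʳ xs x) ⟨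
      ∑ (length (xs ∷ʳ x)) (λ i → rowExcess t m (a ∸ i)) ∎
      where
        open ≡-Reasoning
        n = length xs
        beyond-m : ∀ j → m ≤ j → (a ∸ n) * (m ∸ j) ∸ t ≡ 0
        beyond-m j m≤j rewrite m≤n⇒m∸n≡0 m≤j | *-zeroʳ (a ∸ n) = 0∸n≡0 t

rectangle-telescope : ∀ t {m} xs → All (m ≤_) xs → let n = length xs in
  rowExcess t m (suc n) + ∑cells xs (λ c → rectangle n m c ∸ t)
    ≡ ∑cells xs (λ c → rectangle (suc n) m c ∸ t) + rowExcess t m 1
rectangle-telescope t {m} xs m≤xs = begin
  rowExcess t m (suc n) + ∑cells xs (λ c → rectangle n m c ∸ t)
    ≡⟨ cong (rowExcess t m (suc n) +_) (∑cells-rectangle t m≤xs n) ⟩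
  rowExcess t m (suc n) + ∑ n (λ i → rowExcess t m (n ∸ i))
    ≡⟨ ∑-unfoldˡ n (λ i → rowExcess t m (suc n ∸ i)) ⟨
  ∑ n (λ i → rowExcess t m (suc n ∸ i)) + rowExcess t m (suc n ∸ n)
    ≡⟨ cong₂ _+_ (∑cells-rectangle t m≤xs (suc n)) (cong (rowExcess t m) (sym (m+n∸n≡m 1 n))) ⟨
  ∑cells xs (λ c → rectangle (suc n) m c ∸ t) + rowExcess t m 1 ∎
  where
    open ≡-Reasoning
    n = length xs

∑cells-antiArea-∷ʳ : ∀ t xs x → ∑cells (xs ∷ʳ x) (λ c → antiArea c ∸ t)
                                ≡ ∑cells xs (λ c → antiArea c ∸ t) + rowExcess t x (suc (length xs))
∑cells-antiArea-∷ʳ t xs x = trans (∑cells-∷ʳ xs x _)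
  (cong (∑cells xs (λ c → antiArea c ∸ t) +_) (∑-reverse x (λ v → suc (length xs) * v ∸ t)))

∑cells-area-∷ʳ : ∀ t xs x → ∑cells (xs ∷ʳ x) (λ c → area (xs ∷ʳ x) c ∸ t)
                             ≡ ∑cells xs (λ c → area xs c + rowTail x c ∸ t) + rowExcess t x 1
∑cells-area-∷ʳ t xs x = trans (∑cells-∷ʳ xs x _) (cong₂ _+_ old-rows (∑-cong x new-row))
  where
    n = length xs
    old-rows : ∑cells xs (λ c → area (xs ∷ʳ x) c ∸ t) ≡ ∑cells xs (λ c → area xs c + rowTail x c ∸ t)
    old-rows = cong sum (map-cong-local (All.map (λ i≤n → cong (_∸ t) (area-∷ʳ xs x (m≤n⇒m≤1+n i≤n)))
                                                 (cells-row≤length xs)))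
    new-row : ∀ j → area (xs ∷ʳ x) (suc n , suc j) ∸ t ≡ 1 * (x ∸ j) ∸ t
    new-row j = cong (_∸ t) (begin
      area (xs ∷ʳ x) (suc n , suc j)     ≡⟨ area-∷ʳ xs x ≤-refl ⟩
      area xs (suc n , suc j) + (x ∸ j)  ≡⟨ cong (_+ (x ∸ j)) (area-outside xs ≤-refl) ⟩
      x ∸ j                              ≡⟨ *-identityˡ (x ∸ j) ⟨
      1 * (x ∸ j)                        ∎)
      where open ≡-Reasoning

rectangle-gain≤area-gain : ∀ t {m} xs → All (m ≤_) xs → let n = length xs in
  ∑cells xs (λ c → area xs c ∸ t) + ∑cells xs (λ c → rectangle (suc n) m c ∸ t)
    ≤ ∑cells xs (λ c → area xs c + rowTail m c ∸ t) + ∑cells xs (λ c → rectangle n m c ∸ t)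
rectangle-gain≤area-gain t {m} xs m≤xs = begin
  ∑cells xs (λ c → area xs c ∸ t) + ∑cells xs (λ c → rectangle (suc n) m c ∸ t)
    ≡⟨ sum-map-+ _ _ (cells xs) ⟨
  ∑cells xs (λ c → (area xs c ∸ t) + (rectangle (suc n) m c ∸ t))
    ≤⟨ sum-map-mono (All.map convexity (cells-row≤length xs)) ⟩
  ∑cells xs (λ c → (area xs c + rowTail m c ∸ t) + (rectangle n m c ∸ t))
    ≡⟨ sum-map-+ _ _ (cells xs) ⟩
  ∑cells xs (λ c → area xs c + rowTail m c ∸ t) + ∑cells xs (λ c → rectangle n m c ∸ t) ∎
  where
    open ≤-Reasoning
    n = length xs
    convexity : ∀ {c} → proj₁ c ≤ n →
                (area xs c ∸ t) + (rectangle (suc n) m c ∸ t) ≤ (area xs c + rowTail m c ∸ t) + (rectangle n m c ∸ t)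
    convexity {c} i≤n = begin
      (area xs c ∸ t) + (rectangle (suc n) m c ∸ t)
        ≡⟨ cong (λ v → (area xs c ∸ t) + (v ∸ t)) (rectangle-suc n m c (m≤n⇒m≤1+n i≤n)) ⟩
      (area xs c ∸ t) + (rowTail m c + rectangle n m c ∸ t)
        ≤⟨ ∸-convex t (rowTail m c) (rectangle≤area m≤xs c) ⟩
      (area xs c + rowTail m c ∸ t) + (rectangle n m c ∸ t) ∎

rectangle-gain≡area-gain : ∀ {m} xs → let n = length xs in
  ∑cells xs (area xs) + ∑cells xs (rectangle (suc n) m)
    ≡ ∑cells xs (λ c → area xs c + rowTail m c) + ∑cells xs (rectangle n m)
rectangle-gain≡area-gain {m} xs = begin
  ∑cells xs (area xs) + ∑cells xs (rectangle (suc n) m)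
    ≡⟨ sum-map-+ _ _ (cells xs) ⟨
  ∑cells xs (λ c → area xs c + rectangle (suc n) m c)
    ≡⟨ cong sum (map-cong-local (All.map regroup (cells-row≤length xs))) ⟩
  ∑cells xs (λ c → (area xs c + rowTail m c) + rectangle n m c)
    ≡⟨ sum-map-+ _ _ (cells xs) ⟩
  ∑cells xs (λ c → area xs c + rowTail m c) + ∑cells xs (rectangle n m) ∎
  where
    open ≡-Reasoning
    n = length xs
    regroup : ∀ {c} → proj₁ c ≤ n → area xs c + rectangle (suc n) m c ≡ (area xs c + rowTail m c) + rectangle n m c
    regroup {c} i≤n = trans (cong (area xs c +_) (rectangle-suc n m c (m≤n⇒m≤1+n i≤n)))
                            (sym (+-assoc (area xs c) (rowTail m c) (rectangle n m c)))

antiArea-excess≤area-excess : ∀ {ys} → Linked _≥_ ys → ∀ t →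
                              ∑cells ys (λ c → antiArea c ∸ t) ≤ ∑cells ys (λ c → area ys c ∸ t)
antiArea-excess≤area-excess {ys} = go (reverseView ys)
  where
    go : ∀ {ys} → Reverse ys → Linked _≥_ ys → ∀ t →
         ∑cells ys (λ c → antiArea c ∸ t) ≤ ∑cells ys (λ c → area ys c ∸ t)
    go []             _          t = z≤n
    go (xs ∶ rs ∶ʳ x) xs∷ʳx-desc t with xs-desc , x≤xs ← linked-∷ʳ⁻ xs xs∷ʳx-desc = begin
      ∑cells (xs ∷ʳ x) (λ c → antiArea c ∸ t)  ≡⟨ ∑cells-antiArea-∷ʳ t xs x ⟩
      ∑cells xs (λ c → antiArea c ∸ t) + Wₙ₊₁   ≤⟨ +-monoˡ-≤ Wₙ₊₁ (go rs xs-desc t) ⟩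
      S + Wₙ₊₁                                  ≤⟨ +-exchange-≤ {S} {S′} {Rₙ₊₁} {Rₙ} {Wₙ₊₁} {W₁}
                                                      (rectangle-gain≤area-gain t xs x≤xs)
                                                      (rectangle-telescope t xs x≤xs) ⟩
      S′ + W₁                                   ≡⟨ ∑cells-area-∷ʳ t xs x ⟨
      ∑cells (xs ∷ʳ x) (λ c → area (xs ∷ʳ x) c ∸ t) ∎
      where
        open ≤-Reasoning
        n = length xs
        S S′ Rₙ Rₙ₊₁ Wₙ₊₁ W₁ : ℕ
        S    = ∑cells xs (λ c → area xs c ∸ t)
        S′   = ∑cells xs (λ c → area xs c + rowTail x c ∸ t)
        Rₙ   = ∑cells xs (λ c → rectangle n x c ∸ t)
        Rₙ₊₁ = ∑cells xs (λ c → rectangle (suc n) x c ∸ t)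
        Wₙ₊₁ = rowExcess t x (suc n)
        W₁   = rowExcess t x 1

∑antiArea≡∑area : ∀ {ys} → Linked _≥_ ys → ∑cells ys antiArea ≡ ∑cells ys (area ys)
∑antiArea≡∑area {ys} = go (reverseView ys)
  where
    go : ∀ {ys} → Reverse ys → Linked _≥_ ys → ∑cells ys antiArea ≡ ∑cells ys (area ys)
    go []             _          = refl
    go (xs ∶ rs ∶ʳ x) xs∷ʳx-desc with xs-desc , x≤xs ← linked-∷ʳ⁻ xs xs∷ʳx-desc = begin
      ∑cells (xs ∷ʳ x) antiArea          ≡⟨ ∑cells-antiArea-∷ʳ 0 xs x ⟩
      ∑cells xs antiArea + Wₙ₊₁          ≡⟨ cong (_+ Wₙ₊₁) (go rs xs-desc) ⟩
      S + Wₙ₊₁                           ≡⟨ +-exchange-≡ {S} {S′} {Rₙ₊₁} {Rₙ} {Wₙ₊₁} {W₁}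
                                              (rectangle-gain≡area-gain xs)
                                              (rectangle-telescope 0 xs x≤xs) ⟩
      S′ + W₁                            ≡⟨ ∑cells-area-∷ʳ 0 xs x ⟨
      ∑cells (xs ∷ʳ x) (area (xs ∷ʳ x))  ∎
      where
        open ≡-Reasoning
        n = length xs
        S S′ Rₙ Rₙ₊₁ Wₙ₊₁ W₁ : ℕ
        S    = ∑cells xs (area xs)
        S′   = ∑cells xs (λ c → area xs c + rowTail x c)
        Rₙ   = ∑cells xs (rectangle n x)
        Rₙ₊₁ = ∑cells xs (rectangle (suc n) x)
        Wₙ₊₁ = rowExcess 0 x (suc n)
        W₁   = rowExcess 0 x 1

theorem3p4 : (ys : List ℕ) → IsPartition ys →
    Majorizes (areaMultiset ys) (antiAreaMultiset ys)
theorem3p4 ys (descending , _) = excess≤⇒majorizes (areaMultiset ys) (antiAreaMultiset ys)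
  (trans (length-map (area ys) (cells ys)) (sym (length-map antiArea (cells ys))))
  (sym (∑antiArea≡∑area descending))
  (λ t → subst₂ _≤_ (cong sum (map-∘ (cells ys))) (cong sum (map-∘ (cells ys)))
                    (antiArea-excess≤area-excess descending t))
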